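{- There exists an infinite family of strings $w$, with lengths $n=|w|$ unbounded over the family, such that $v(w^R)/v(w)=\Theta(\log n)$, i.e., there are constants $c_1,c_2>0$ with $c_1\log n\le v(w^R)/v(w)\le c_2\log n$ for all sufficiently long $w$ in the family.
   Context: Strings are over a finite totally ordered alphabet, compared lexicographically. For $w=w[1]\cdots w[n]$, $w^R=w[n]\cdots w[1]$. The lex-parse of $w$ is the factorization $w=x_1\cdots x_v$ defined left to right: if phrase $x_j$ starts at position $i=1+\sum_{t<j}|x_t|$, its length is $\max\{1,\ell\}$, where $\ell$ is the length of the longest common prefix of the suffix $w[i\ldots n]$ and the suffix of $w$ immediately preceding it in the lexicographic order of all suffixes of $w$ ($\ell=0$ if $w[i\ldots n]$ is the lexicographically smallest suffix). $v(w)$ is the number of phrases of the lex-parse. -}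

module Defs where

open import Data.Nat using (ℕ; zero; suc; _+_; _⊔_; _<ᵇ_)
open import Data.Fin using (Fin; toℕ)
open import Data.List using (List; []; _∷_; length; drop; take; map; upTo; foldl)
open import Data.Maybe using (Maybe; just; nothing; maybe′)
open import Data.Bool using (Bool; true; false; if_then_else_)

Str : ℕ → Set
Str σ = List (Fin σ)

lexLt : ∀ {σ} → Str σ → Str σ → Bool
lexLt [] [] = false
lexLt [] (_ ∷ _) = true
lexLt (_ ∷ _) [] = false
lexLt (a ∷ x) (b ∷ y) with toℕ a <ᵇ toℕ b | toℕ b <ᵇ toℕ a
... | true  | _     = true
... | false | true  = false
... | false | false = lexLt x y

lcp : ∀ {σ} → Str σ → Str σ → ℕ
lcp [] _ = 0
lcp (_ ∷ _) [] = 0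
lcp (a ∷ x) (b ∷ y) with toℕ a <ᵇ toℕ b | toℕ b <ᵇ toℕ a
... | false | false = suc (lcp x y)
... | _     | _     = 0

suffixes : ∀ {σ} → Str σ → List (Str σ)
suffixes w = map (λ j → drop j w) (upTo (length w))

-- The suffix of w immediately preceding s in lexicographic order
-- (the lex-largest suffix of w that is lex-smaller than s), if any.
predSuffix : ∀ {σ} → Str σ → Str σ → Maybe (Str σ)
predSuffix {σ} w s = foldl step nothing (suffixes w)
  where
  step : Maybe (Str σ) → Str σ → Maybe (Str σ)
  step acc t = if lexLt t s
               then maybe′ (λ b → if lexLt b t then just t else just b) (just t) acc
               else acc

phraseLen : ∀ {σ} → Str σ → ℕ → ℕ
phraseLen w i = 1 ⊔ maybe′ (lcp (drop i w)) 0 (predSuffix w (drop i w))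

-- Lex-parse computed left to right; fuel bounds the number of phrases
-- (each phrase has length ≥ 1, so fuel = |w| suffices).
lexParseFrom : ∀ {σ} → ℕ → Str σ → ℕ → List (Str σ)
lexParseFrom zero w i = []
lexParseFrom (suc f) w i =
  if i <ᵇ length w
  then take (phraseLen w i) (drop i w) ∷ lexParseFrom f w (i + phraseLen w i)
  else []

lexParse : ∀ {σ} → Str σ → List (Str σ)
lexParse w = lexParseFrom (length w) w 0

v : ∀ {σ} → Str σ → ℕ
v w = length (lexParse w)

-- Let fib be the Fibonacci words with fib (m + 2) = fib m ++ fib (m + 1); they satisfy
-- fib (m + 1) = ψ (fib m) for the morphism ψ : a ↦ ba, b ↦ a.  The combinatorial core is a
-- rigidity property: a suffix of a Fibonacci word sharing more than |fib j| letters with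
-- fib (j + 2) = fib j ++ fib (j + 1) has all of fib (j + 2) as a prefix.  It is proved for
-- the tails of the fib j by desubstituting suffixes along ψ, and it says that the suffix
-- preceding fib (j + 2) lexicographically shares exactly fib j with it.  Hence the lex-parse
-- of fib m cuts off fib (m - 2), fib (m - 3), ..., fib 0 in turn, leaving fib 1 = ba for one
-- or two final phrases; so v (fib m) ∈ {m, m + 1}, while log |fib m| lies between m / 2 and m.
--
-- Conversely fib (2k) and fib (2k + 1) commute up to swapping the first two letters, so the
-- reversal w of fib (2k + 2) is both U ++ A ++ ba and A ++ ab ++ U.  The border U makes the
-- first phrase at least |U| long, and a phrase starting inside the second occurrence of A
-- runs to its end, because the same remainder of A followed by ab occurs earlier and is
-- smaller.  So v w ≤ 4.

{-# OPTIONS --safe #-}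
module Submission where

open import Defs
open import Data.Bool using (true; false; if_then_else_)
open import Data.Bool.Properties using (T-≡)
open import Data.Fin as Fin using (Fin; toℕ)
import Data.Fin.Properties as Finₚ
open import Data.List using ([]; _∷_; _++_; length; drop; take; foldl; reverse)
open import Data.List.Membership.Propositional using (_∈_)
open import Data.List.Membership.Propositional.Properties using (∈-map⁺; ∈-map⁻; ∈-upTo⁺)
open import Data.List.Properties
  using (length-++; length-++-sucʳ; length-take; length-drop; take++drop≡id; ++-assoc; ∷-injectiveʳ;
         reverse-++; length-reverse; reverse-involutive)
open import Data.List.Relation.Unary.Any using (here; there)
open import Data.Maybe using (Maybe; just; nothing; maybe′)
open import Data.Nat
open import Data.Nat.Logarithm using (⌊log₂_⌋; ⌊log₂⌋-mono-≤; ⌊log₂[2^n]⌋≡n)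
open import Data.Nat.Properties
open import Data.Product using (Σ; ∃-syntax; _×_; _,_; proj₂)
open import Data.Sum using (_⊎_; inj₁; inj₂)
open import Function using (_∘_)
open import Function.Bundles using (Equivalence)
open import Relation.Binary.Definitions using (tri<; tri≈; tri>)
open import Relation.Binary.PropositionalEquality
open import Relation.Nullary using (yes; no; contradiction)

<⇒<ᵇ≡true : ∀ {m n} → m < n → (m <ᵇ n) ≡ true
<⇒<ᵇ≡true = Equivalence.to T-≡ ∘ <⇒<ᵇ

≮⇒<ᵇ≡false : ∀ {m n} → m ≮ n → (m <ᵇ n) ≡ false
≮⇒<ᵇ≡false {m} {n} m≮n with m <ᵇ n in eq
... | false = refl
... | true  = contradiction (<ᵇ⇒< m n (Equivalence.from T-≡ eq)) m≮n

module _ {σ : ℕ} where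

  -- Lexicographic order and longest common prefixes

  lexLt-∷-< : ∀ {c d : Fin σ} {x y} → c Fin.< d → lexLt (c ∷ x) (d ∷ y) ≡ true
  lexLt-∷-< c<d rewrite <⇒<ᵇ≡true c<d = refl

  lexLt-∷-> : ∀ {c d : Fin σ} {x y} → d Fin.< c → lexLt (c ∷ x) (d ∷ y) ≡ false
  lexLt-∷-> d<c rewrite ≮⇒<ᵇ≡false (<-asym d<c) | <⇒<ᵇ≡true d<c = refl

  lexLt-∷-≡ : ∀ (c : Fin σ) x y → lexLt (c ∷ x) (c ∷ y) ≡ lexLt x y
  lexLt-∷-≡ c x y rewrite ≮⇒<ᵇ≡false (<-irrefl {toℕ c} refl) = refl

  lcp-∷-< : ∀ {c d : Fin σ} {x y} → c Fin.< d → lcp (c ∷ x) (d ∷ y) ≡ 0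
  lcp-∷-< c<d rewrite <⇒<ᵇ≡true c<d = refl

  lcp-∷-> : ∀ {c d : Fin σ} {x y} → d Fin.< c → lcp (c ∷ x) (d ∷ y) ≡ 0
  lcp-∷-> d<c rewrite ≮⇒<ᵇ≡false (<-asym d<c) | <⇒<ᵇ≡true d<c = refl

  lcp-∷-≡ : ∀ (c : Fin σ) x y → lcp (c ∷ x) (c ∷ y) ≡ suc (lcp x y)
  lcp-∷-≡ c x y rewrite ≮⇒<ᵇ≡false (<-irrefl {toℕ c} refl) = refl

  infix 4 _<ₗ_ _≤ₗ_

  _<ₗ_ : Str σ → Str σ → Set
  x <ₗ y = lexLt x y ≡ true

  _≤ₗ_ : Str σ → Str σ → Set
  x ≤ₗ y = x ≡ y ⊎ x <ₗ y

  <ₗ-∷⁻ : ∀ {c d : Fin σ} {x y} → c ∷ x <ₗ d ∷ y → c Fin.< d ⊎ (c ≡ d × x <ₗ y)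
  <ₗ-∷⁻ {c} {d} {x} {y} lt with Finₚ.<-cmp c d
  ... | tri< c<d _ _ = inj₁ c<d
  ... | tri≈ _ refl _ = inj₂ (refl , trans (sym (lexLt-∷-≡ c x y)) lt)
  ... | tri> _ _ d<c with () ← trans (sym (lexLt-∷-> d<c)) lt

  <ₗ-trans : ∀ {x y z : Str σ} → x <ₗ y → y <ₗ z → x <ₗ z
  <ₗ-trans {[]}    {_ ∷ _} {_ ∷ _} _ _ = refl
  <ₗ-trans {_ ∷ _} {_ ∷ _} {[]}    _ ()
  <ₗ-trans {c ∷ x} {d ∷ y} {e ∷ z} x<y y<z
    with <ₗ-∷⁻ {c} {d} {x} {y} x<y | <ₗ-∷⁻ {d} {e} {y} {z} y<z
  ... | inj₁ c<d          | inj₁ d<e          = lexLt-∷-< (<-trans c<d d<e)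
  ... | inj₁ c<d          | inj₂ (refl , _)   = lexLt-∷-< c<d
  ... | inj₂ (refl , _)   | inj₁ d<e          = lexLt-∷-< d<e
  ... | inj₂ (refl , x<y′) | inj₂ (refl , y<z′) =
    trans (lexLt-∷-≡ c x z) (<ₗ-trans {x} {y} {z} x<y′ y<z′)

  ≤ₗ-<ₗ-trans : ∀ {x y z : Str σ} → x ≤ₗ y → y <ₗ z → x <ₗ z
  ≤ₗ-<ₗ-trans (inj₁ refl) y<z = y<z
  ≤ₗ-<ₗ-trans {x} {y} {z} (inj₂ x<y) y<z = <ₗ-trans {x} {y} {z} x<y y<z

  ≮ₗ⇒≥ₗ : ∀ {x y : Str σ} → lexLt x y ≡ false → y ≤ₗ x
  ≮ₗ⇒≥ₗ {[]}    {[]}    _  = inj₁ refl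
  ≮ₗ⇒≥ₗ {_ ∷ _} {[]}    _  = inj₂ refl
  ≮ₗ⇒≥ₗ {c ∷ x} {d ∷ y} x≮y with Finₚ.<-cmp c d
  ... | tri< c<d _ _ with () ← trans (sym (lexLt-∷-< c<d)) x≮y
  ... | tri> _ _ d<c = inj₂ (lexLt-∷-< d<c)
  ... | tri≈ _ refl _ with ≮ₗ⇒≥ₗ {x} {y} (trans (sym (lexLt-∷-≡ c x y)) x≮y)
  ...   | inj₁ refl = inj₁ refl
  ...   | inj₂ y<x  = inj₂ (trans (lexLt-∷-≡ c y x) y<x)

  lcp-sym : ∀ (x y : Str σ) → lcp x y ≡ lcp y x
  lcp-sym []      []      = refl
  lcp-sym []      (_ ∷ _) = refl
  lcp-sym (_ ∷ _) []      = refl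
  lcp-sym (c ∷ x) (d ∷ y) with Finₚ.<-cmp c d
  ... | tri< c<d _ _ = trans (lcp-∷-< c<d) (sym (lcp-∷-> c<d))
  ... | tri> _ _ d<c = trans (lcp-∷-> d<c) (sym (lcp-∷-< d<c))
  ... | tri≈ _ refl _ =
    trans (lcp-∷-≡ c x y) (trans (cong suc (lcp-sym x y)) (sym (lcp-∷-≡ c y x)))

  lcp-mono-<ₗ : ∀ {t p s : Str σ} → t <ₗ p → p <ₗ s → lcp t s ≤ lcp p s
  lcp-mono-<ₗ {[]}    _ _ = z≤n
  lcp-mono-<ₗ {c ∷ t} {d ∷ p} {e ∷ s} t<p p<s
    with <ₗ-∷⁻ {c} {d} {t} {p} t<p | <ₗ-∷⁻ {d} {e} {p} {s} p<s
  ... | inj₁ c<d        | inj₁ d<e        = ≤-trans (≤-reflexive (lcp-∷-< (<-trans c<d d<e))) z≤n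
  ... | inj₁ c<d        | inj₂ (refl , _) = ≤-trans (≤-reflexive (lcp-∷-< c<d)) z≤n
  ... | inj₂ (refl , _) | inj₁ d<e        = ≤-trans (≤-reflexive (lcp-∷-< d<e)) z≤n
  ... | inj₂ (refl , t<p′) | inj₂ (refl , p<s′) rewrite lcp-∷-≡ c t s | lcp-∷-≡ c p s =
    s≤s (lcp-mono-<ₗ {t} {p} {s} t<p′ p<s′)

  lcp-mono-≤ₗ : ∀ {t p s : Str σ} → t ≤ₗ p → p <ₗ s → lcp s t ≤ lcp s p
  lcp-mono-≤ₗ             (inj₁ refl) _   = ≤-refl
  lcp-mono-≤ₗ {t} {p} {s} (inj₂ t<p)  p<s rewrite lcp-sym s t | lcp-sym s p =
    lcp-mono-<ₗ {t} {p} {s} t<p p<s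

  lexLt-++ : ∀ (d x y : Str σ) → lexLt (d ++ x) (d ++ y) ≡ lexLt x y
  lexLt-++ []      x y = refl
  lexLt-++ (c ∷ d) x y = trans (lexLt-∷-≡ c (d ++ x) (d ++ y)) (lexLt-++ d x y)

  lcp-++ : ∀ (d x y : Str σ) → lcp (d ++ x) (d ++ y) ≡ length d + lcp x y
  lcp-++ []      x y = refl
  lcp-++ (c ∷ d) x y = trans (lcp-∷-≡ c (d ++ x) (d ++ y)) (cong suc (lcp-++ d x y))

  ++-≮ₗ : ∀ (s r : Str σ) → lexLt (s ++ r) s ≡ false
  ++-≮ₗ []      []      = refl
  ++-≮ₗ []      (_ ∷ _) = refl
  ++-≮ₗ (c ∷ s) r       = trans (lexLt-∷-≡ c (s ++ r) s) (++-≮ₗ s r)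

  <ₗ-++ : ∀ (s : Str σ) {r} → 0 < length r → s <ₗ s ++ r
  <ₗ-++ []      {_ ∷ _} _   = refl
  <ₗ-++ (d ∷ s) {r}     0<r = trans (lexLt-∷-≡ d s (s ++ r)) (<ₗ-++ s 0<r)

  lcp-++ʳ : ∀ (s r : Str σ) → lcp (s ++ r) s ≡ length s
  lcp-++ʳ []      []      = refl
  lcp-++ʳ []      (_ ∷ _) = refl
  lcp-++ʳ (c ∷ s) r       = trans (lcp-∷-≡ c (s ++ r) s) (cong suc (lcp-++ʳ s r))

  -- Phrase lengths and phrase counts of the lex-parse

  drop-length-++ : ∀ (P s : Str σ) → drop (length P) (P ++ s) ≡ s
  drop-length-++ []      s = refl
  drop-length-++ (_ ∷ P) s = drop-length-++ P s

  length-<-++ : ∀ (P : Str σ) {t} → 0 < length t → length P < length (P ++ t)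
  length-<-++ P {t} 0<t = subst (length P <_) (sym (length-++ P)) (m<m+n (length P) 0<t)

  ∈-suffixes⁺ : ∀ (P : Str σ) {t} → 0 < length t → t ∈ suffixes (P ++ t)
  ∈-suffixes⁺ P {t} 0<t = subst (_∈ suffixes (P ++ t)) (drop-length-++ P t)
                            (∈-map⁺ (λ j → drop j (P ++ t)) (∈-upTo⁺ (length-<-++ P 0<t)))

  ∈-suffixes⁻ : ∀ {t w : Str σ} → t ∈ suffixes w → ∃[ P ] w ≡ P ++ t
  ∈-suffixes⁻ {w = w} t∈ with ∈-map⁻ (λ j → drop j w) t∈
  ... | j , _ , refl = take j w , sym (take++drop≡id j w)

  -- predSuffix w s unfolds definitionally to foldl (predStep s) nothing (suffixes w).
  predStep : Str σ → Maybe (Str σ) → Str σ → Maybe (Str σ)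
  predStep s acc t = if lexLt t s
                     then maybe′ (λ b → if lexLt b t then just t else just b) (just t) acc
                     else acc

  Dominates : Str σ → Maybe (Str σ) → Set
  Dominates t acc = ∃[ q ] acc ≡ just q × t ≤ₗ q

  predStep-dominates : ∀ {s t x acc} → Dominates t acc → Dominates t (predStep s acc x)
  predStep-dominates {s} {t} {x} (q , refl , t≤q) with lexLt x s
  ... | false = q , refl , t≤q
  ... | true with lexLt q x in q<x
  ...   | true  = x , refl , inj₂ (≤ₗ-<ₗ-trans {t} {q} {x} t≤q q<x)
  ...   | false = q , refl , t≤q

  predStep-hit : ∀ {s x} acc → x <ₗ s → Dominates x (predStep s acc x)
  predStep-hit {s} {x} acc x<s rewrite x<s with acc
  ... | nothing = x , refl , inj₁ refl
  ... | just b with lexLt b x in b≮x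
  ...   | true  = x , refl , inj₁ refl
  ...   | false = b , refl , ≮ₗ⇒≥ₗ {b} {x} b≮x

  predStep-sound : ∀ {s x p} acc → predStep s acc x ≡ just p → acc ≡ just p ⊎ (p ≡ x × x <ₗ s)
  predStep-sound {s} {x} acc eq with lexLt x s
  ... | false = inj₁ eq
  ... | true with acc
  ...   | nothing with refl ← eq = inj₂ (refl , refl)
  ...   | just b with lexLt b x | eq
  ...     | true  | refl = inj₂ (refl , refl)
  ...     | false | refl = inj₁ refl

  foldl-dominates : ∀ {s t} acc xs → Dominates t acc → Dominates t (foldl (predStep s) acc xs)
  foldl-dominates acc []       d = d
  foldl-dominates acc (x ∷ xs) d = foldl-dominates _ xs (predStep-dominates d)

  foldl-hit : ∀ {s t} acc xs → t ∈ xs → t <ₗ s → Dominates t (foldl (predStep s) acc xs)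
  foldl-hit acc (x ∷ xs) (here refl) t<s = foldl-dominates _ xs (predStep-hit acc t<s)
  foldl-hit acc (x ∷ xs) (there t∈)  t<s = foldl-hit _ xs t∈ t<s

  foldl-sound : ∀ {s p} acc xs → foldl (predStep s) acc xs ≡ just p →
                acc ≡ just p ⊎ (p ∈ xs × p <ₗ s)
  foldl-sound acc []       eq = inj₁ eq
  foldl-sound acc (x ∷ xs) eq with foldl-sound (predStep _ acc x) xs eq
  ... | inj₂ (p∈ , p<s) = inj₂ (there p∈ , p<s)
  ... | inj₁ eq′ with predStep-sound acc eq′
  ...   | inj₁ eq″           = inj₁ eq″
  ...   | inj₂ (refl , x<s) = inj₂ (here refl , x<s)

  predSuffix-sound : ∀ {w s p : Str σ} → predSuffix w s ≡ just p → p ∈ suffixes w × p <ₗ s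
  predSuffix-sound {w} eq with foldl-sound nothing (suffixes w) eq
  ... | inj₂ r = r

  predSuffix-dominates : ∀ {w s t : Str σ} → t ∈ suffixes w → t <ₗ s →
                         ∃[ q ] predSuffix w s ≡ just q × t ≤ₗ q × q <ₗ s
  predSuffix-dominates {w} {s} t∈ t<s with foldl-hit nothing (suffixes w) t∈ t<s
  ... | q , eq , t≤q = q , eq , t≤q , proj₂ (predSuffix-sound {w} {s} eq)

  phraseLen-≥ : ∀ (P s : Str σ) {t} → t ∈ suffixes (P ++ s) → t <ₗ s →
                lcp s t ≤ phraseLen (P ++ s) (length P)
  phraseLen-≥ P s {t} t∈ t<s rewrite drop-length-++ P s
    with predSuffix-dominates {P ++ s} {s} {t} t∈ t<s
  ... | q , eq , t≤q , q<s rewrite eq =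
    ≤-trans (lcp-mono-≤ₗ {t} {q} {s} t≤q q<s) (m≤n⊔m 1 (lcp s q))

  phraseLen-≤ : ∀ (P s : Str σ) B → (∀ {t} → t ∈ suffixes (P ++ s) → t <ₗ s → lcp s t ≤ B) →
                phraseLen (P ++ s) (length P) ≤ 1 ⊔ B
  phraseLen-≤ P s B bound rewrite drop-length-++ P s = ⊔-monoʳ-≤ 1 lcp-pred≤B
    where
    lcp-pred≤B : maybe′ (lcp s) 0 (predSuffix (P ++ s) s) ≤ B
    lcp-pred≤B with predSuffix (P ++ s) s in eq
    ... | nothing = z≤n
    ... | just p  = let p∈ , p<s = predSuffix-sound {P ++ s} {s} eq in bound p∈ p<s

  phraseLen-pos : ∀ (w : Str σ) i → 1 ≤ phraseLen w i
  phraseLen-pos w i = m≤m⊔n 1 (maybe′ (lcp (drop i w)) 0 (predSuffix w (drop i w)))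

  phraseCount : ℕ → Str σ → ℕ → ℕ
  phraseCount f w i = length (lexParseFrom f w i)

  phraseCount-step : ∀ f (w : Str σ) {i} → i < length w →
                     phraseCount (suc f) w i ≡ suc (phraseCount f w (i + phraseLen w i))
  phraseCount-step f w i<n rewrite <⇒<ᵇ≡true i<n = refl

  phraseCount-≤ : ∀ f (w : Str σ) i → phraseCount f w i ≤ length w ∸ i
  phraseCount-≤ zero    w i = z≤n
  phraseCount-≤ (suc f) w i with i <? length w
  ... | no i≮n rewrite ≮⇒<ᵇ≡false i≮n = z≤n
  ... | yes i<n rewrite phraseCount-step f w i<n = begin
    suc (phraseCount f w (i + phraseLen w i)) ≤⟨ s≤s (phraseCount-≤ f w _) ⟩
    suc (length w ∸ (i + phraseLen w i))
      ≤⟨ s≤s (∸-monoʳ-≤ (length w) (m<m+n i (phraseLen-pos w i))) ⟩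
    suc (length w ∸ suc i)                    ≡⟨ +-∸-assoc 1 i<n ⟨
    length w ∸ i                              ∎
    where open ≤-Reasoning

  phraseCount-jump : ∀ f (w : Str σ) {i e} → (∀ {c} → i ≤ c → c < e → e ≤ c + phraseLen w c) →
                     ∀ {c} → i ≤ c → phraseCount f w c ≤ suc (length w ∸ e)
  phraseCount-jump f w {e = e} jump {c} i≤c with c <? e
  ... | no c≮e =
    ≤-trans (phraseCount-≤ f w c) (≤-trans (∸-monoʳ-≤ (length w) (≮⇒≥ c≮e)) (n≤1+n _))
  phraseCount-jump zero    w jump i≤c | yes c<e = z≤n
  phraseCount-jump (suc f) w {e = e} jump {c} i≤c | yes c<e with c <? length w
  ... | yes c<n rewrite phraseCount-step f w c<n =
    s≤s (≤-trans (phraseCount-≤ f w _) (∸-monoʳ-≤ (length w) (jump i≤c c<e)))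
  ... | no c≮n =
    ≤-trans (phraseCount-≤ (suc f) w c) (≤-trans (≤-reflexive (m≤n⇒m∸n≡0 (≮⇒≥ c≮n))) z≤n)

  v-pos : ∀ (w : Str σ) → 0 < length w → 0 < v w
  v-pos (_ ∷ _) _ = z<s

  v-≤-suc : ∀ (w : Str σ) {B} → (∀ f → phraseCount f w (phraseLen w 0) ≤ B) → v w ≤ suc B
  v-≤-suc []      _     = z≤n
  v-≤-suc (_ ∷ w) bound = s≤s (bound (length w))

  phraseLen-border : ∀ (u r : Str σ) P → 0 < length r → u ++ r ≡ P ++ u →
                     length u ≤ phraseLen (u ++ r) 0
  phraseLen-border []      r P _   _  = z≤n
  phraseLen-border (d ∷ u) r P 0<r eq =
    subst (_≤ phraseLen w 0) (lcp-++ʳ (d ∷ u) r)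
      (phraseLen-≥ [] w {d ∷ u} (subst (λ z → d ∷ u ∈ suffixes z) (sym eq) (∈-suffixes⁺ P z<s))
                   (<ₗ-++ (d ∷ u) 0<r))
    where
    w : Str σ
    w = d ∷ u ++ r

  phraseLen-swap : ∀ {x y : Fin σ} P D R Q → x Fin.< y →
                   P ++ D ++ y ∷ x ∷ [] ≡ Q ++ D ++ x ∷ y ∷ R →
                   length D ≤ phraseLen (P ++ D ++ y ∷ x ∷ []) (length P)
  phraseLen-swap {x} {y} P D R Q x<y eq =
    subst (_≤ phraseLen (P ++ s) (length P)) lcp≡
      (phraseLen-≥ P s (subst (λ z → t ∈ suffixes z) (sym eq) (∈-suffixes⁺ Q 0<t)) t<s)
    where
    s t : Str σ
    s = D ++ y ∷ x ∷ []
    t = D ++ x ∷ y ∷ R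
    0<t : 0 < length t
    0<t = subst (0 <_) (sym (length-++-sucʳ D x (y ∷ R))) z<s
    t<s : t <ₗ s
    t<s = trans (lexLt-++ D (x ∷ y ∷ R) (y ∷ x ∷ [])) (lexLt-∷-< x<y)
    lcp≡ : lcp s t ≡ length D
    lcp≡ = trans (lcp-++ D (y ∷ x ∷ []) (x ∷ y ∷ R))
                 (trans (cong (length D +_) (lcp-∷-> x<y)) (+-identityʳ (length D)))

  module SwappedEnds {x y : Fin σ} (U A : Str σ) (x<y : x Fin.< y)
                     (swap : U ++ A ++ y ∷ x ∷ [] ≡ A ++ x ∷ y ∷ U) where

    w : Str σ
    w = U ++ A ++ y ∷ x ∷ []

    firstPhrase-≥ : length U ≤ phraseLen w 0
    firstPhrase-≥ = phraseLen-border U (A ++ y ∷ x ∷ []) (A ++ x ∷ y ∷ [])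
                      (subst (0 <_) (sym (length-++-sucʳ A y (x ∷ []))) z<s)
                      (trans swap (sym (++-assoc A (x ∷ y ∷ []) U)))

    phrase-crosses-A : ∀ {c} → length U ≤ c → c < length U + length A →
                       length U + length A ≤ c + phraseLen w c
    phrase-crosses-A {c} U≤c c<UA = begin
      length U + length A                   ≡⟨ cong (length U +_) (m+[n∸m]≡n k≤A) ⟨
      length U + (k + (length A ∸ k))       ≡⟨ +-assoc (length U) k _ ⟨
      length U + k + (length A ∸ k)         ≡⟨ cong₂ _+_ (m+[n∸m]≡n U≤c) (sym (length-drop k A)) ⟩
      c + length D                          ≤⟨ +-monoʳ-≤ c D≤phraseLen ⟩
      c + phraseLen w c                     ∎
      where
      open ≤-Reasoning
      k = c ∸ length U
      A₁ = take k A
      D = drop k A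
      k≤A : k ≤ length A
      k≤A = m≤n+o⇒m∸n≤o c (length U) (<⇒≤ c<UA)
      length-UA₁ : length (U ++ A₁) ≡ c
      length-UA₁ = trans (length-++ U)
        (trans (cong (length U +_) (trans (length-take k A) (m≤n⇒m⊓n≡m k≤A))) (m+[n∸m]≡n U≤c))
      w≡ : w ≡ (U ++ A₁) ++ D ++ y ∷ x ∷ []
      w≡ = trans (cong (λ B → U ++ B ++ y ∷ x ∷ []) (sym (take++drop≡id k A)))
           (trans (cong (U ++_) (++-assoc A₁ D _)) (sym (++-assoc U A₁ _)))
      swap′ : (U ++ A₁) ++ D ++ y ∷ x ∷ [] ≡ A₁ ++ D ++ x ∷ y ∷ U
      swap′ = trans (sym w≡) (trans swap
              (trans (cong (_++ x ∷ y ∷ U) (sym (take++drop≡id k A))) (++-assoc A₁ D _)))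
      D≤phraseLen : length D ≤ phraseLen w c
      D≤phraseLen = subst₂ (λ z i → length D ≤ phraseLen z i) (sym w≡) length-UA₁
                      (phraseLen-swap (U ++ A₁) D U A₁ x<y swap′)

    ∣w∣∸∣UA∣≡2 : length w ∸ (length U + length A) ≡ 2
    ∣w∣∸∣UA∣≡2 = begin
      length w ∸ e                              ≡⟨ cong (_∸ e) (length-++ U) ⟩
      length U + length (A ++ y ∷ x ∷ []) ∸ e   ≡⟨ cong (λ n → length U + n ∸ e) (length-++ A) ⟩
      length U + (length A + 2) ∸ e             ≡⟨ cong (_∸ e) (+-assoc (length U) (length A) 2) ⟨
      e + 2 ∸ e                                 ≡⟨ m+n∸m≡n e 2 ⟩
      2                                         ∎
      where
      open ≡-Reasoning
      e = length U + length A

    v-≤-4 : v w ≤ 4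
    v-≤-4 = v-≤-suc w λ f →
      subst (phraseCount f w (phraseLen w 0) ≤_) (cong suc ∣w∣∸∣UA∣≡2)
        (phraseCount-jump f w phrase-crosses-A firstPhrase-≥)

-- Fibonacci words and their rigidity

pattern a = Fin.zero
pattern b = Fin.suc Fin.zero

-- fib m is the reversal of the Fibonacci word f m, where f 0 = a, f 1 = ab and
-- f (m + 2) = f (m + 1) ++ f m; so family k below is f (2k).
fib : ℕ → Str 2
fib zero          = a ∷ []
fib (suc zero)    = b ∷ a ∷ []
fib (suc (suc m)) = fib m ++ fib (suc m)

ψ : Str 2 → Str 2
ψ []      = []
ψ (a ∷ w) = b ∷ a ∷ ψ w
ψ (b ∷ w) = a ∷ ψ w

ψ-++ : ∀ x y → ψ (x ++ y) ≡ ψ x ++ ψ y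
ψ-++ []      y = refl
ψ-++ (a ∷ x) y = cong (λ z → b ∷ a ∷ z) (ψ-++ x y)
ψ-++ (b ∷ x) y = cong (a ∷_) (ψ-++ x y)

fib-suc : ∀ m → fib (suc m) ≡ ψ (fib m)
fib-suc zero          = refl
fib-suc (suc zero)    = refl
fib-suc (suc (suc m)) =
  trans (cong₂ _++_ (fib-suc m) (fib-suc (suc m))) (sym (ψ-++ (fib m) (fib (suc m))))

FibSuffix : Str 2 → Set
FibSuffix t = ∃[ M ] ∃[ P ] fib M ≡ P ++ t

FibSuffix-∷ : ∀ {c t} → FibSuffix (c ∷ t) → FibSuffix t
FibSuffix-∷ {c} {t} (M , P , eq) = M , P ++ c ∷ [] , trans eq (sym (++-assoc P (c ∷ []) t))

ψ-split : ∀ X P {t} → ψ X ≡ P ++ t → ∃[ X₁ ] ∃[ X₂ ] X ≡ X₁ ++ X₂ × (t ≡ ψ X₂ ⊎ t ≡ a ∷ ψ X₂)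
ψ-split []      []            refl = [] , [] , refl , inj₁ refl
ψ-split (a ∷ X) []            refl = [] , a ∷ X , refl , inj₁ refl
ψ-split (a ∷ X) (b ∷ [])      refl = a ∷ [] , X , refl , inj₂ refl
ψ-split (a ∷ X) (b ∷ a ∷ P)   eq with ψ-split X P (∷-injectiveʳ (∷-injectiveʳ eq))
... | X₁ , X₂ , refl , t≡ = a ∷ X₁ , X₂ , refl , t≡
ψ-split (b ∷ X) []            refl = [] , b ∷ X , refl , inj₁ refl
ψ-split (b ∷ X) (a ∷ P)       eq with ψ-split X P (∷-injectiveʳ eq)
... | X₁ , X₂ , refl , t≡ = b ∷ X₁ , X₂ , refl , t≡

FibSuffix-desubst : ∀ {t} → FibSuffix t → ∃[ V ] FibSuffix V × (t ≡ ψ V ⊎ t ≡ a ∷ ψ V)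
FibSuffix-desubst (zero , []         , refl) = [] , (zero , a ∷ [] , refl) , inj₂ refl
FibSuffix-desubst (zero , (a ∷ [])   , refl) = [] , (zero , a ∷ [] , refl) , inj₁ refl
FibSuffix-desubst (suc M , P , eq) with ψ-split (fib M) P (trans (sym (fib-suc M)) eq)
... | X₁ , X₂ , fibM≡ , t≡ = X₂ , (M , X₁ , fibM≡) , t≡

FibSuffix-a : ∀ {t} → FibSuffix (a ∷ t) → ∃[ V ] FibSuffix V × t ≡ ψ V
FibSuffix-a s with FibSuffix-desubst s
... | b ∷ V , sV , inj₁ refl = V , FibSuffix-∷ sV , refl
... | V     , sV , inj₂ refl = V , sV , refl

FibSuffix-b : ∀ {t} → FibSuffix (b ∷ t) → ∃[ V ] FibSuffix (a ∷ V) × t ≡ a ∷ ψ V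
FibSuffix-b s with FibSuffix-desubst s
... | a ∷ V , sV , inj₁ refl = V , sV , refl
... | b ∷ V , _  , inj₁ ()

record Rigid (u r : Str 2) : Set where
  field
    extend : ∀ {t} → FibSuffix t → length u < lcp t (u ++ r) → ∃[ t′ ] t ≡ (u ++ r) ++ t′
open Rigid

Rigid-∷ : ∀ {u r} c → Rigid u r → Rigid (c ∷ u) r
Rigid-∷ a rig .extend {a ∷ t} st lt with extend rig (FibSuffix-∷ st) (≤-pred lt)
... | t′ , refl = t′ , refl
Rigid-∷ b rig .extend {b ∷ t} st lt with extend rig (FibSuffix-∷ st) (≤-pred lt)
... | t′ , refl = t′ , refl
Rigid-∷ a rig .extend {[]}    st ()
Rigid-∷ a rig .extend {b ∷ t} st ()
Rigid-∷ b rig .extend {[]}    st ()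
Rigid-∷ b rig .extend {a ∷ t} st ()

ψ-lcp-reflect : ∀ u V r → length (ψ u) < lcp (ψ V) (ψ u ++ ψ r) → length u < lcp V (u ++ r)
ψ-lcp-reflect []      (a ∷ V) (a ∷ r) _  = s≤s z≤n
ψ-lcp-reflect []      (b ∷ V) (b ∷ r) _  = s≤s z≤n
ψ-lcp-reflect (a ∷ u) (a ∷ V) r       lt = s≤s (ψ-lcp-reflect u V r (≤-pred (≤-pred lt)))
ψ-lcp-reflect (b ∷ u) (b ∷ V) r       lt = s≤s (ψ-lcp-reflect u V r (≤-pred lt))
ψ-lcp-reflect []      []      _       ()
ψ-lcp-reflect []      (a ∷ V) []      ()
ψ-lcp-reflect []      (a ∷ V) (b ∷ r) ()
ψ-lcp-reflect []      (b ∷ V) []      ()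
ψ-lcp-reflect []      (b ∷ V) (a ∷ r) ()
ψ-lcp-reflect (a ∷ u) []      _       ()
ψ-lcp-reflect (a ∷ u) (b ∷ V) _       ()
ψ-lcp-reflect (b ∷ u) []      _       ()
ψ-lcp-reflect (b ∷ u) (a ∷ V) _       ()

ψ-rigid : ∀ {u r V} → Rigid u r → FibSuffix V → length (ψ u) < lcp (ψ V) (ψ u ++ ψ r) →
          ∃[ t′ ] ψ V ≡ (ψ u ++ ψ r) ++ t′
ψ-rigid {u} {r} {V} rig sV lt with extend rig sV (ψ-lcp-reflect u V r lt)
... | t′ , refl = ψ t′ , trans (ψ-++ (u ++ r) t′) (cong (_++ ψ t′) (ψ-++ u r))

Rigid-aψ : ∀ {u r} → Rigid u r → Rigid (a ∷ ψ u) (ψ r)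
Rigid-aψ rig .extend {a ∷ t} st lt with FibSuffix-a st
... | V , sV , refl with ψ-rigid rig sV (≤-pred lt)
...   | t′ , eq = t′ , cong (a ∷_) eq
Rigid-aψ rig .extend {[]}    st ()
Rigid-aψ rig .extend {b ∷ t} st ()

Rigid-ψ : ∀ {u r} → Rigid (a ∷ u) r → Rigid (ψ (a ∷ u)) (ψ r)
Rigid-ψ rig .extend {b ∷ t} st lt with FibSuffix-b st
... | V , sV , refl = ψ-rigid rig sV lt
Rigid-ψ rig .extend {[]}    st ()
Rigid-ψ rig .extend {a ∷ t} st ()

Rigid-fib₁ : Rigid [] (fib 1)
Rigid-fib₁ .extend {b ∷ t} st lt with FibSuffix-b st
... | V , _ , refl = ψ V , refl
Rigid-fib₁ .extend {[]}    st ()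
Rigid-fib₁ .extend {a ∷ t} st ()

-- The shape of fib j decides whether Rigid-aψ or Rigid-ψ carries the rigidity of its tail
-- over to fib (j + 1); the two shapes alternate.
data TailRigid (j : ℕ) : Set where
  head-a  : ∀ X → fib j ≡ a ∷ X     → Rigid X       (fib (suc j)) → TailRigid j
  head-ba : ∀ X → fib j ≡ b ∷ a ∷ X → Rigid (a ∷ X) (fib (suc j)) → TailRigid j

tailRigid : ∀ j → TailRigid j
tailRigid zero = head-a [] refl Rigid-fib₁
tailRigid (suc j) with tailRigid j
... | head-a X eq rig =
  head-ba (ψ X) (trans (fib-suc j) (cong ψ eq))
          (subst (Rigid (a ∷ ψ X)) (sym (fib-suc (suc j))) (Rigid-aψ rig))
... | head-ba X eq rig =
  head-a (ψ (a ∷ X)) (trans (fib-suc j) (cong ψ eq))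
         (subst (Rigid (ψ (a ∷ X))) (sym (fib-suc (suc j))) (Rigid-ψ rig))

rigid-fib : ∀ j → Rigid (fib j) (fib (suc j))
rigid-fib j with tailRigid j
... | head-a  X eq rig = subst (λ u → Rigid u (fib (suc j))) (sym eq) (Rigid-∷ a rig)
... | head-ba X eq rig = subst (λ u → Rigid u (fib (suc j))) (sym eq) (Rigid-∷ b rig)

Rigid-lcp-≤ : ∀ {u r t} → Rigid u r → FibSuffix t → t <ₗ u ++ r → lcp (u ++ r) t ≤ length u
Rigid-lcp-≤ {u} {r} {t} rig st t<ur with length u <? lcp t (u ++ r)
... | no u≮lcp = subst (_≤ length u) (lcp-sym t (u ++ r)) (≮⇒≥ u≮lcp)
... | yes u<lcp with extend rig st u<lcp
...   | t′ , refl = contradiction (trans (sym t<ur) (++-≮ₗ (u ++ r) t′)) λ ()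

-- The lex-parses of the Fibonacci words and of their reversals

length-fib-≥ : ∀ j → suc j ≤ length (fib j)
length-fib-≥ zero          = s≤s z≤n
length-fib-≥ (suc zero)    = s≤s (s≤s z≤n)
length-fib-≥ (suc (suc j)) = subst (suc (suc (suc j)) ≤_) (sym (length-++ (fib j)))
                               (+-mono-≤ (≤-trans (s≤s z≤n) (length-fib-≥ j)) (length-fib-≥ (suc j)))

fib-nonempty : ∀ j → 0 < length (fib j)
fib-nonempty j = ≤-trans (s≤s z≤n) (length-fib-≥ j)

fib-suffix : ∀ j → ∃[ Q ] fib (suc j) ≡ Q ++ fib j
fib-suffix zero    = b ∷ [] , refl
fib-suffix (suc j) = fib j , refl

phraseLen-fib : ∀ {m} P j → fib m ≡ P ++ fib (suc (suc j)) →
                phraseLen (fib m) (length P) ≡ length (fib j)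
phraseLen-fib {m} P j eq =
  subst (λ w → phraseLen w (length P) ≡ length (fib j)) (sym eq) (≤-antisym upper lower)
  where
  s : Str 2
  s = fib (suc (suc j))
  fib-j∈ : fib j ∈ suffixes (P ++ s)
  fib-j∈ with fib-suffix j
  ... | Q , Q≡ =
    subst (λ z → fib j ∈ suffixes z) P++s≡ (∈-suffixes⁺ (P ++ fib j ++ Q) (fib-nonempty j))
    where
    P++s≡ : (P ++ fib j ++ Q) ++ fib j ≡ P ++ s
    P++s≡ = trans (++-assoc P _ (fib j))
              (cong (P ++_) (trans (++-assoc (fib j) Q (fib j)) (cong (fib j ++_) (sym Q≡))))
  lower : length (fib j) ≤ phraseLen (P ++ s) (length P)
  lower = subst (_≤ phraseLen (P ++ s) (length P)) (lcp-++ʳ (fib j) (fib (suc j)))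
            (phraseLen-≥ P s fib-j∈ (<ₗ-++ (fib j) (fib-nonempty (suc j))))
  below-rigid : ∀ {t} → t ∈ suffixes (P ++ s) → t <ₗ s → lcp s t ≤ length (fib j)
  below-rigid t∈ t<s with ∈-suffixes⁻ t∈
  ... | P′ , e = Rigid-lcp-≤ (rigid-fib j) (m , P′ , trans eq e) t<s
  upper : phraseLen (P ++ s) (length P) ≤ length (fib j)
  upper = subst (phraseLen (P ++ s) (length P) ≤_) (m≤n⇒m⊔n≡n (fib-nonempty j))
            (phraseLen-≤ P s (length (fib j)) below-rigid)

length-prefix-< : ∀ {m} P j → fib m ≡ P ++ fib j → length P < length (fib m)
length-prefix-< P j eq = subst (λ w → length P < length w) (sym eq) (length-<-++ P (fib-nonempty j))

phraseCount-fib-step : ∀ {m} P j f → fib m ≡ P ++ fib (suc (suc j)) →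
  phraseCount (suc f) (fib m) (length P) ≡ suc (phraseCount f (fib m) (length (P ++ fib j)))
phraseCount-fib-step {m} P j f eq =
  trans (phraseCount-step f (fib m) (length-prefix-< {m} P (suc (suc j)) eq))
        (cong (λ i → suc (phraseCount f (fib m) i))
              (trans (cong (length P +_) (phraseLen-fib {m} P j eq)) (sym (length-++ P))))

phraseCount-fib-≥ : ∀ {m} P j f → fib m ≡ P ++ fib (suc j) → suc j ≤ f →
                    suc j ≤ phraseCount f (fib m) (length P)
phraseCount-fib-≥ {m} P zero (suc f) eq _ =
  subst (1 ≤_) (sym (phraseCount-step f (fib m) (length-prefix-< {m} P 1 eq))) (s≤s z≤n)
phraseCount-fib-≥ {m} P (suc j) (suc f) eq (s≤s j<f) =
  subst (suc (suc j) ≤_) (sym (phraseCount-fib-step {m} P j f eq))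
    (s≤s (phraseCount-fib-≥ {m} (P ++ fib j) j f (trans eq (sym (++-assoc P (fib j) _))) j<f))

phraseCount-fib-≤ : ∀ {m} P j f → fib m ≡ P ++ fib (suc j) →
                    phraseCount f (fib m) (length P) ≤ suc (suc j)
phraseCount-fib-≤ {m} P zero f eq =
  ≤-trans (phraseCount-≤ f (fib m) (length P))
          (≤-reflexive (trans (cong (λ w → length w ∸ length P) eq)
                              (trans (cong (_∸ length P) (length-++ P)) (m+n∸m≡n (length P) 2))))
phraseCount-fib-≤ P (suc j) zero    eq = z≤n
phraseCount-fib-≤ {m} P (suc j) (suc f) eq =
  subst (_≤ suc (suc (suc j))) (sym (phraseCount-fib-step {m} P j f eq))
    (s≤s (phraseCount-fib-≤ {m} (P ++ fib j) j f (trans eq (sym (++-assoc P (fib j) _)))))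

v-fib : ∀ j → suc j ≤ v (fib (suc j)) × v (fib (suc j)) ≤ suc (suc j)
v-fib j = phraseCount-fib-≥ {suc j} [] j n refl (≤-trans (n≤1+n (suc j)) (length-fib-≥ (suc j)))
        , phraseCount-fib-≤ {suc j} [] j n refl
  where n = length (fib (suc j))

fib-near-commute : ∀ k → ∃[ Y ] fib (suc (k * 2)) ≡ b ∷ a ∷ Y
                              × fib (k * 2) ++ fib (suc (k * 2)) ≡ a ∷ b ∷ Y ++ fib (k * 2)
fib-near-commute zero = [] , refl , refl
fib-near-commute (suc k) with fib-near-commute k
... | Y , e₁ , e₂ = Y ++ fib (suc (suc d)) , cong (_++ fib (suc (suc d))) e₁ , (begin
  fib (suc (suc d)) ++ fib (suc d) ++ fib (suc (suc d))
    ≡⟨ ++-assoc (fib (suc (suc d))) (fib (suc d)) _ ⟨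
  (fib (suc (suc d)) ++ fib (suc d)) ++ fib (suc (suc d))
    ≡⟨ cong (λ z → (z ++ fib (suc d)) ++ fib (suc (suc d))) e₂ ⟩
  ((a ∷ b ∷ Y ++ fib d) ++ fib (suc d)) ++ fib (suc (suc d))
    ≡⟨ cong (λ z → (a ∷ b ∷ z) ++ fib (suc (suc d))) (++-assoc Y (fib d) (fib (suc d))) ⟩
  (a ∷ b ∷ Y ++ fib (suc (suc d))) ++ fib (suc (suc d))
    ∎)
  where
  open ≡-Reasoning
  d = k * 2

reverse-fib-swapped : ∀ k → ∃[ U ] ∃[ A ] reverse (fib (suc k * 2)) ≡ U ++ A ++ b ∷ a ∷ []
                                         × U ++ A ++ b ∷ a ∷ [] ≡ A ++ a ∷ b ∷ U
reverse-fib-swapped k with fib-near-commute k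
... | Y , e₁ , e₂ = U , A , rev≡UAba , trans (sym rev≡UAba) rev≡AabU
  where
  open ≡-Reasoning
  d = k * 2
  U = reverse (fib d)
  A = reverse Y
  rev≡UAba : reverse (fib (suc k * 2)) ≡ U ++ A ++ b ∷ a ∷ []
  rev≡UAba = begin
    reverse (fib d ++ fib (suc d))        ≡⟨ cong reverse e₂ ⟩
    reverse ((a ∷ b ∷ Y) ++ fib d)        ≡⟨ reverse-++ (a ∷ b ∷ Y) (fib d) ⟩
    U ++ reverse ((a ∷ b ∷ []) ++ Y)      ≡⟨ cong (U ++_) (reverse-++ (a ∷ b ∷ []) Y) ⟩
    U ++ A ++ b ∷ a ∷ []                  ∎
  rev≡AabU : reverse (fib (suc k * 2)) ≡ A ++ a ∷ b ∷ U
  rev≡AabU = begin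
    reverse (fib d ++ fib (suc d))        ≡⟨ reverse-++ (fib d) (fib (suc d)) ⟩
    reverse (fib (suc d)) ++ U            ≡⟨ cong (λ z → reverse z ++ U) e₁ ⟩
    reverse ((b ∷ a ∷ []) ++ Y) ++ U      ≡⟨ cong (_++ U) (reverse-++ (b ∷ a ∷ []) Y) ⟩
    (A ++ a ∷ b ∷ []) ++ U                ≡⟨ ++-assoc A (a ∷ b ∷ []) U ⟩
    A ++ a ∷ b ∷ U                        ∎

length-fib-mono : ∀ m → length (fib m) ≤ length (fib (suc m))
length-fib-mono zero    = s≤s z≤n
length-fib-mono (suc m) = subst (length (fib (suc m)) ≤_) (sym (length-++ (fib m)))
                            (m≤n+m (length (fib (suc m))) (length (fib m)))

length-fib-suc-≤ : ∀ m → length (fib (suc m)) ≤ 2 * length (fib m)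
length-fib-suc-≤ zero    = ≤-refl
length-fib-suc-≤ (suc m) = begin
  length (fib m ++ fib (suc m))               ≡⟨ length-++ (fib m) ⟩
  length (fib m) + length (fib (suc m))       ≤⟨ +-monoˡ-≤ _ (length-fib-mono m) ⟩
  length (fib (suc m)) + length (fib (suc m)) ≡⟨ cong (length (fib (suc m)) +_) (+-identityʳ _) ⟨
  2 * length (fib (suc m))                    ∎
  where open ≤-Reasoning

length-fib-≤-2^ : ∀ m → length (fib m) ≤ 2 ^ m
length-fib-≤-2^ zero    = ≤-refl
length-fib-≤-2^ (suc m) = ≤-trans (length-fib-suc-≤ m) (*-monoʳ-≤ 2 (length-fib-≤-2^ m))

2^-≤-length-fib : ∀ k → 2 ^ k ≤ length (fib (k * 2))
2^-≤-length-fib zero    = ≤-refl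
2^-≤-length-fib (suc k) = begin
  2 * 2 ^ k                                      ≤⟨ *-monoʳ-≤ 2 (2^-≤-length-fib k) ⟩
  length (fib d) + (length (fib d) + 0)          ≡⟨ cong (length (fib d) +_) (+-identityʳ _) ⟩
  length (fib d) + length (fib d)                ≤⟨ +-monoʳ-≤ (length (fib d)) (length-fib-mono d) ⟩
  length (fib d) + length (fib (suc d))          ≡⟨ length-++ (fib d) ⟨
  length (fib (suc (suc d)))                     ∎
  where
  open ≤-Reasoning
  d = k * 2

ratio-bounds : ∀ {k lg vF vG} → 1 ≤ k → k ≤ lg → lg ≤ k * 2 → 1 ≤ vF → vF ≤ 4 →
               k * 2 ≤ vG → vG ≤ suc (k * 2) → 1 * lg * vF ≤ 4 * vG × 1 * vG ≤ 3 * lg * vF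
ratio-bounds {k} {lg} {vF} {vG} 1≤k k≤lg lg≤2k 1≤vF vF≤4 2k≤vG vG≤1+2k = lower , upper
  where
  open ≤-Reasoning
  lower : 1 * lg * vF ≤ 4 * vG
  lower = begin
    1 * lg * vF    ≡⟨ cong (_* vF) (*-identityˡ lg) ⟩
    lg * vF        ≤⟨ *-mono-≤ lg≤2k vF≤4 ⟩
    k * 2 * 4      ≡⟨ *-comm (k * 2) 4 ⟩
    4 * (k * 2)    ≤⟨ *-monoʳ-≤ 4 2k≤vG ⟩
    4 * vG         ∎
  upper : 1 * vG ≤ 3 * lg * vF
  upper = begin
    1 * vG         ≡⟨ *-identityˡ vG ⟩
    vG             ≤⟨ vG≤1+2k ⟩
    1 + k * 2      ≤⟨ +-monoˡ-≤ (k * 2) 1≤k ⟩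
    k + k * 2      ≡⟨ *-suc k 2 ⟨
    k * 3          ≡⟨ *-comm k 3 ⟩
    3 * k          ≤⟨ *-monoʳ-≤ 3 k≤lg ⟩
    3 * lg         ≡⟨ *-identityʳ (3 * lg) ⟨
    3 * lg * 1     ≤⟨ *-monoʳ-≤ (3 * lg) 1≤vF ⟩
    3 * lg * vF    ∎

family : ℕ → Str 2
family k = reverse (fib (k * 2))

family-unbounded : ∀ m → m ≤ length (family m)
family-unbounded m = subst (m ≤_) (sym (length-reverse (fib (m * 2))))
                       (≤-trans (m≤m*n m 2) (≤-trans (n≤1+n _) (length-fib-≥ (m * 2))))

log-length-family : ∀ k → k ≤ ⌊log₂ length (family k) ⌋ × ⌊log₂ length (family k) ⌋ ≤ k * 2
log-length-family k rewrite length-reverse (fib (k * 2)) =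
    subst (_≤ ⌊log₂ n ⌋) (⌊log₂[2^n]⌋≡n k) (⌊log₂⌋-mono-≤ (2^-≤-length-fib k))
  , subst (⌊log₂ n ⌋ ≤_) (⌊log₂[2^n]⌋≡n (k * 2)) (⌊log₂⌋-mono-≤ (length-fib-≤-2^ (k * 2)))
  where n = length (fib (k * 2))

v-family-pos : ∀ k → 1 ≤ v (family k)
v-family-pos k =
  v-pos (family k) (subst (0 <_) (sym (length-reverse (fib (k * 2)))) (fib-nonempty (k * 2)))

v-family-≤-4 : ∀ k → v (family (suc k)) ≤ 4
v-family-≤-4 k with reverse-fib-swapped k
... | U , A , rev≡ , swap = subst (λ w → v w ≤ 4) (sym rev≡) (SwappedEnds.v-≤-4 U A z<s swap)

v-reverse-family : ∀ k → suc k * 2 ≤ v (reverse (family (suc k)))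
                       × v (reverse (family (suc k))) ≤ suc (suc k * 2)
v-reverse-family k rewrite reverse-involutive (fib (suc k * 2)) = v-fib (suc (k * 2))

proposition5p4 : ∃[ σ ] Σ (ℕ → Str σ) (λ fam →
    (∀ m → ∃[ k ] m ≤ length (fam k)) ×
    ∃[ p ] ∃[ q ] ∃[ r ] ∃[ s ] (0 < p × 0 < q × 0 < r × 0 < s ×
      ∃[ N ] (∀ k → N ≤ length (fam k) →
        (p * ⌊log₂ length (fam k) ⌋ * v (fam k) ≤ q * v (reverse (fam k)))
        × (s * v (reverse (fam k)) ≤ r * ⌊log₂ length (fam k) ⌋ * v (fam k)))))
proposition5p4 =
  2 , family , (λ m → m , family-unbounded m) , 1 , 4 , 3 , 1 , z<s , z<s , z<s , z<s , 2 , bounds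
  where
  bounds : ∀ k → 2 ≤ length (family k) →
           1 * ⌊log₂ length (family k) ⌋ * v (family k) ≤ 4 * v (reverse (family k))
           × 1 * v (reverse (family k)) ≤ 3 * ⌊log₂ length (family k) ⌋ * v (family k)
  bounds zero    (s≤s ())
  bounds (suc k) _ =
    let k≤lg , lg≤2k = log-length-family (suc k)
        2k≤vG , vG≤1+2k = v-reverse-family k
    in ratio-bounds (s≤s z≤n) k≤lg lg≤2k (v-family-pos (suc k)) (v-family-≤-4 k) 2k≤vG vG≤1+2k
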